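{- Let $p$ be a prime such that $p\equiv 1\pmod{6}$. Then \begin{align*} \frac{(1/3)_{(2p+1)/3}^2}{(1)_{(2p+1)/3}^2}\bigg\{1+6p^2-\sum_{i=1}^{(2p+1)/3}\frac{4p^2}{(3i-2)^2}\bigg\} \equiv-3p^2\Gamma_p(2/3)^6 \pmod{p^3}. \end{align*}
   Context: For a complex number $x$, $(x)_0=1$ and $(x)_k=x(x+1)\cdots(x+k-1)$ for positive integers $k$. $\mathbb{Z}_p$ denotes the ring of $p$-adic integers, and congruences modulo $p^3$ are taken in $\mathbb{Z}_p$. $\Gamma_p$ is Morita's $p$-adic Gamma function: $\Gamma_p(0)=1$, $\Gamma_p(n)=(-1)^n\prod_{1\le k<n,\ p\nmid k}k$ for positive integers $n$, extended to $x\in\mathbb{Z}_p$ by $\Gamma_p(x)=\lim_{n\in\mathbb{N},\,|x-n|_p\to0}\Gamma_p(n)$. -}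

module Defs where

open import Data.Nat as ℕ using (ℕ; zero; suc)
open import Data.Nat.DivMod as ℕD using ()
open import Data.Nat.Divisibility as ℕDiv using (_∣?_)
open import Data.Integer as ℤ using (ℤ; +_)
open import Data.Integer.Divisibility as ℤDiv using ()
open import Data.Rational as ℚ using (ℚ; 0ℚ; 1ℚ)
open import Data.Product using (_×_)
open import Relation.Nullary using (¬_; yes; no)
open import Data.Rational.Properties using () renaming (_≟_ to _≟ℚ_)

ι : ℕ → ℚ
ι n = (+ n) ℚ./ 1

-- total division on ℚ (q ÷' 0 := 0; only used with nonzero divisors)
_÷'_ : ℚ → ℚ → ℚ
a ÷' b with b ≟ℚ 0ℚ
... | yes _ = 0ℚ
... | no b≢0 = a ℚ.* ℚ.1/_ b {{ℚ.≢-nonZero b≢0}}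

poch : ℚ → ℕ → ℚ
poch x zero    = 1ℚ
poch x (suc k) = poch x k ℚ.* (x ℚ.+ ι k)

sumFrom1 : (ℕ → ℚ) → ℕ → ℚ
sumFrom1 f zero    = 0ℚ
sumFrom1 f (suc k) = sumFrom1 f k ℚ.+ f (suc k)

-- ∏_{1 ≤ k < n, p ∤ k} k   (k = 0 is excluded automatically since p ∣ 0)
prodCoprime : ℕ → ℕ → ℕ
prodCoprime p zero    = 1
prodCoprime p (suc m) with p ∣? m
... | yes _ = prodCoprime p m
... | no  _ = prodCoprime p m ℕ.* m

-- Morita's p-adic Gamma function at a natural number n:
-- Γ_p(n) = (-1)^n ∏_{1 ≤ k < n, p ∤ k} k   (Γ_p(0) = 1)
Γp : ℕ → ℕ → ℤ
Γp p n = (ℤ.- ℤ.1ℤ) ℤ.^ n ℤ.* (+ prodCoprime p n)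

-- Congruence in ℤ_p between a rational q and an integer c modulo p^m:
-- q is p-integral (p ∤ denominator) and p^m ∣ numerator(q) - c·denominator(q).
CongZp : ℕ → ℕ → ℚ → ℤ → Set
CongZp p m q c =
  (¬ (p ℕDiv.∣ ℚ.ℚ.denominatorℕ q)) ×
  ((+ (p ℕ.^ m)) ℤDiv.∣ (ℚ.ℚ.numerator q ℤ.- c ℤ.* ℚ.ℚ.denominator q))

lhs : ℕ → ℚ
lhs p =
  ((poch third k ℚ.* poch third k) ÷' (poch 1ℚ k ℚ.* poch 1ℚ k)) ℚ.*
  ((1ℚ ℚ.+ ι (6 ℕ.* p ℕ.* p)) ℚ.- sumFrom1 term k)
  where
  k : ℕ
  k = (2 ℕ.* p ℕ.+ 1) ℕD./ 3
  third : ℚ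
  third = (+ 1) ℚ./ 3
  term : ℕ → ℚ
  term zero    = 0ℚ
  term (suc j) = ι (4 ℕ.* p ℕ.* p) ℚ.* r ℚ.* r
    where r = (+ 1) ℚ./ suc (3 ℕ.* j)

-- Write p = 3a + 1, so that (2p + 1)/3 = k = 2a + 1. As 1/3 + a = p/3, exactly one factor of
-- (1/3)_k is divisible by p, so the left side is p² W with W p-integral, and the claim is
-- W ≡ −3 Γ_p(2/3)⁶ (mod p). Modulo p we have 1/3 ≡ −a, hence (1/3)_a² ≡ a!² and
-- (1/3 + a + 1)_a ≡ a!; in the bracket only the summand with 3i − 2 = p survives, so it is
-- ≡ 1 − 4 = −3. The square of Wilson's theorem gives the reflection formula (j! m!)² ≡ 1 for
-- j + m = p − 1, which turns 1/(9 k!²) into a!², so W ≡ −3 a!⁶. On the other side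
-- Γ_p(n + p) = ±(p − 1)! Γ_p(n), so Γ_p(N)² only depends on N mod p, and 3N ≡ 2 forces
-- N ≡ a + 1, whence Γ_p(N)² ≡ Γ_p(a + 1)² = a!².
module Submission where

open import Defs
open import Algebra.Bundles using (CommutativeMonoid)
open import Data.Nat.Base as ℕ using (ℕ; zero; suc; NonZero; _!)
import Data.Nat.Properties as ℕ
import Data.Nat.DivMod as ℕ
import Data.Nat.Divisibility as ℕ
import Data.Integer.Base as ℤ
import Data.Integer.Properties as ℤ
import Data.Integer.Divisibility as ℤ
open import Data.Nat.Primality using (Prime; prime⇒nonZero; prime⇒nonTrivial; euclidsLemma)
open import Data.Product.Base using (Σ; ∃-syntax; _×_; _,_; proj₁; proj₂)
open import Level using (0ℓ)
open import Relation.Binary.PropositionalEquality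
open import Relation.Binary.Bundles using (PartialSetoid)
open import Relation.Binary.Structures using (IsEquivalence; IsPartialEquivalence)
import Relation.Binary.Reasoning.Setoid
import Relation.Binary.Reasoning.PartialSetoid

module Congruence (n : ℕ) .{{_ : NonZero n}} where
  open import Data.Nat.Base
  open import Data.Nat.Properties using (*-assoc; *-comm; *-identityˡ; *-identityʳ; ≤-total; m∸n+n≡m)
  open import Data.Nat.DivMod using (%-distribˡ-*; %-remove-+ˡ; [m+n]%n≡m%n; [m+kn]%n≡m%n; m<n⇒m%n≡m)
  open import Data.Nat.Divisibility using (_∣_)
  open import Data.Sum.Base using (inj₁; inj₂)

  infix 4 _≡ₘ_
  -- A record rather than the bare equation of remainders, so that x and y can be inferred.
  record _≡ₘ_ (x y : ℕ) : Set where
    constructor mod-≡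
    field
      %-≡ : x % n ≡ y % n

  open _≡ₘ_ public

  ≡ₘ-isEquivalence : IsEquivalence _≡ₘ_
  ≡ₘ-isEquivalence = record
    { refl = mod-≡ refl
    ; sym = λ x≡y → mod-≡ (sym (%-≡ x≡y))
    ; trans = λ x≡y y≡z → mod-≡ (trans (%-≡ x≡y) (%-≡ y≡z))
    }

  open IsEquivalence ≡ₘ-isEquivalence public
    using () renaming (refl to ≡ₘ-refl; sym to ≡ₘ-sym; trans to ≡ₘ-trans)

  ≡⇒≡ₘ : ∀ {x y} → x ≡ y → x ≡ₘ y
  ≡⇒≡ₘ x≡y = mod-≡ (cong (_% n) x≡y)

  *-cong-≡ₘ : ∀ {x x′ y y′} → x ≡ₘ x′ → y ≡ₘ y′ → x * y ≡ₘ x′ * y′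
  *-cong-≡ₘ {x} {x′} {y} {y′} (mod-≡ x≡x′) (mod-≡ y≡y′) = mod-≡ (begin
    (x * y) % n                ≡⟨ %-distribˡ-* x y n ⟩
    ((x % n) * (y % n)) % n    ≡⟨ cong₂ (λ u v → (u * v) % n) x≡x′ y≡y′ ⟩
    ((x′ % n) * (y′ % n)) % n  ≡⟨ %-distribˡ-* x′ y′ n ⟨
    (x′ * y′) % n              ∎)
    where open ≡-Reasoning

  *-congˡ-≡ₘ : ∀ x {y y′} → y ≡ₘ y′ → x * y ≡ₘ x * y′
  *-congˡ-≡ₘ x = *-cong-≡ₘ {x} {x} (mod-≡ refl)

  *-congʳ-≡ₘ : ∀ y {x x′} → x ≡ₘ x′ → x * y ≡ₘ x′ * y
  *-congʳ-≡ₘ y x≡x′ = *-cong-≡ₘ {y = y} {y} x≡x′ (mod-≡ refl)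

  +-≡ₘ : ∀ x → x + n ≡ₘ x
  +-≡ₘ x = mod-≡ ([m+n]%n≡m%n x n)

  +-*-≡ₘ : ∀ x k → x + k * n ≡ₘ x
  +-*-≡ₘ x k = mod-≡ ([m+kn]%n≡m%n x k n)

  ≡ₘ∧<⇒≡ : ∀ {x y} → x ≡ₘ y → x < n → y < n → x ≡ y
  ≡ₘ∧<⇒≡ (mod-≡ x%n≡y%n) x<n y<n = trans (sym (m<n⇒m%n≡m x<n)) (trans x%n≡y%n (m<n⇒m%n≡m y<n))

  ∣∸⇒≡ₘ : ∀ {x y} → y ≤ x → n ∣ x ∸ y → x ≡ₘ y
  ∣∸⇒≡ₘ {x} {y} y≤x n∣x∸y = mod-≡ (trans (cong (_% n) (sym (m∸n+n≡m y≤x))) (%-remove-+ˡ y n∣x∸y))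

  ∣⊖⇒≡ₘ : ∀ x y → n ∣ ℤ.∣ x ℤ.⊖ y ∣ → x ≡ₘ y
  ∣⊖⇒≡ₘ x y n∣x⊖y with ≤-total y x
  ... | inj₁ y≤x = ∣∸⇒≡ₘ y≤x (subst (n ∣_) (trans (ℤ.∣m⊖n∣≡∣n⊖m∣ x y) (ℤ.∣⊖∣-≤ y≤x)) n∣x⊖y)
  ... | inj₂ x≤y = ≡ₘ-sym (∣∸⇒≡ₘ x≤y (subst (n ∣_) (ℤ.∣⊖∣-≤ x≤y) n∣x⊖y))

  ∣-⇒≡ₘ : ∀ x y → ℤ.+ n ℤ.∣ ℤ.+ x ℤ.- ℤ.+ y → x ≡ₘ y
  ∣-⇒≡ₘ x y n∣x-y = ∣⊖⇒≡ₘ x y (subst (n ∣_) (cong ℤ.∣_∣ (ℤ.m-n≡m⊖n x y)) n∣x-y)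

  *-1-commutativeMonoid : CommutativeMonoid 0ℓ 0ℓ
  *-1-commutativeMonoid = record
    { Carrier = ℕ
    ; _≈_ = _≡ₘ_
    ; _∙_ = _*_
    ; ε = 1
    ; isCommutativeMonoid = record
      { isMonoid = record
        { isSemigroup = record
          { isMagma = record
            { isEquivalence = ≡ₘ-isEquivalence
            ; ∙-cong = *-cong-≡ₘ
            }
          ; assoc = λ x y z → ≡⇒≡ₘ (*-assoc x y z)
          }
        ; identity = (λ x → ≡⇒≡ₘ (*-identityˡ x)) , (λ x → ≡⇒≡ₘ (*-identityʳ x))
        }
      ; comm = λ x y → ≡⇒≡ₘ (*-comm x y)
      }
    }

  module ≡ₘ-Reasoning = Relation.Binary.Reasoning.Setoid (CommutativeMonoid.setoid *-1-commutativeMonoid)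

module Wilson (m : ℕ) (prime : Prime (suc m)) where
  open import Data.Nat.Base
  open import Data.Nat.Properties
    using (*-comm; *-assoc; *-identityˡ; *-identityʳ; *-zeroʳ; +-suc; +-comm; +-identityʳ; suc-injective; 0≢1+n; ≤-pred)
  open import Data.Nat.DivMod using (m%n<n; m<n⇒m%n≡m; m%n%n≡m%n)
  open import Data.Nat.Coprimality as Coprime using (coprime-Bézout; prime⇒coprime)
  open import Data.Nat.GCD using (module Bézout)
  open import Data.Nat.Tactic.RingSolver using (solve-∀)
  open import Data.Fin.Base using (Fin; toℕ; fromℕ<; fromℕ)
  open import Data.Vec.Functional using (init; last)
  open import Data.Fin.Properties using (toℕ-injective; toℕ-fromℕ<; toℕ-inject₁; toℕ-fromℕ; toℕ<n)
  open import Data.Fin.Permutation using (Permutation; permutation)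
  open import Data.Empty using (⊥-elim)
  open Congruence (suc m)
  open ≡ₘ-Reasoning
  open import Algebra.Properties.CommutativeMonoid.Sum *-1-commutativeMonoid
    using (sum; sum-permute; ∑-distrib-+; sum-cong-≋; sum-cong-≗; sum-init-last; sum-replicate-zero)

  private
    p : ℕ
    p = suc m

    1%p≡1 : 1 % p ≡ 1
    1%p≡1 = m<n⇒m%n≡m (nonTrivial⇒n>1 p {{prime⇒nonTrivial prime}})

  inverse-unique : ∀ {x y z} → x * y ≡ₘ 1 → x * z ≡ₘ 1 → y ≡ₘ z
  inverse-unique {x} {y} {z} xy≡1 xz≡1 = begin
    y            ≡⟨ *-identityʳ y ⟨
    y * 1        ≈⟨ *-congˡ-≡ₘ y xz≡1 ⟨
    y * (x * z)  ≡⟨ *-assoc y x z ⟨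
    y * x * z    ≡⟨ cong (_* z) (*-comm y x) ⟩
    x * y * z    ≈⟨ *-congʳ-≡ₘ z xy≡1 ⟩
    1 * z        ≡⟨ *-identityˡ z ⟩
    z            ∎

  inverse : ∀ x → 0 < x → x < p → ∃[ y ] x * y ≡ₘ 1
  inverse x 0<x x<p with coprime-Bézout (Coprime.sym (prime⇒coprime prime {{>-nonZero 0<x}} x<p))
  ... | Bézout.+- u v 1+vp≡ux = u , (begin
    x * u      ≡⟨ *-comm x u ⟩
    u * x      ≡⟨ 1+vp≡ux ⟨
    1 + v * p  ≈⟨ +-*-≡ₘ 1 v ⟩
    1          ∎)
  ... | Bézout.-+ u v 1+ux≡vp = m * u , (begin
    x * (m * u)                  ≈⟨ +-*-≡ₘ (x * (m * u)) v ⟨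
    x * (m * u) + v * p          ≡⟨ cong (x * (m * u) +_) 1+ux≡vp ⟨
    x * (m * u) + (1 + u * x)    ≡⟨ rearrange x u m ⟩
    1 + (u * x) * p              ≈⟨ +-*-≡ₘ 1 (u * x) ⟩
    1                            ∎)
    where
    rearrange : ∀ x u m → x * (m * u) + (1 + u * x) ≡ 1 + (u * x) * suc m
    rearrange = solve-∀

  residue : Fin m → ℕ
  residue i = suc (toℕ i)

  residue<p : ∀ i → residue i < p
  residue<p i = s≤s (toℕ<n i)

  inverseᶠ : (i : Fin m) → Σ (Fin m) λ j → residue i * residue j ≡ₘ 1
  inverseᶠ i with inverse (residue i) z<s (residue<p i)
  ... | y , xy≡1 with y % p in y%p≡r | m%n<n y p
  ...   | zero  | _ = ⊥-elim (0≢1+n (trans (%-≡ (begin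
    0              ≡⟨ *-zeroʳ (residue i) ⟨
    residue i * 0  ≈⟨ *-congˡ-≡ₘ (residue i) (mod-≡ y%p≡r) ⟨
    residue i * y  ≈⟨ xy≡1 ⟩
    1              ∎)) 1%p≡1))
  ...   | suc j | j<m = fromℕ< (≤-pred j<m) , (begin
    residue i * residue (fromℕ< (≤-pred j<m))  ≡⟨ cong (λ k → residue i * suc k) (toℕ-fromℕ< _) ⟩
    residue i * suc j                          ≡⟨ cong (residue i *_) y%p≡r ⟨
    residue i * (y % p)                        ≈⟨ *-congˡ-≡ₘ (residue i) (mod-≡ (m%n%n≡m%n y p)) ⟩
    residue i * y                              ≈⟨ xy≡1 ⟩
    1                                          ∎)

  inv : Fin m → Fin m
  inv i = proj₁ (inverseᶠ i)

  inv-involutive : ∀ i → inv (inv i) ≡ i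
  inv-involutive i = toℕ-injective (suc-injective (≡ₘ∧<⇒≡ inv-inv-i≡i (residue<p (inv (inv i))) (residue<p i)))
    where
    inv-i*i≡1 : residue (inv i) * residue i ≡ₘ 1
    inv-i*i≡1 = ≡ₘ-trans (≡⇒≡ₘ (*-comm (residue (inv i)) (residue i))) (proj₂ (inverseᶠ i))
    inv-inv-i≡i : residue (inv (inv i)) ≡ₘ residue i
    inv-inv-i≡i = inverse-unique {residue (inv i)} (proj₂ (inverseᶠ (inv i))) inv-i*i≡1

  inv-permutation : Permutation m m
  inv-permutation = permutation inv inv inv-involutive inv-involutive

  ∏-residue≡! : ∀ n → sum (λ (i : Fin n) → suc (toℕ i)) ≡ₘ n !
  ∏-residue≡! zero    = ≡ₘ-refl
  ∏-residue≡! (suc n) = begin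
    sum f                                      ≈⟨ sum-init-last f ⟩
    sum (init f) * last f                      ≡⟨ cong₂ _*_ (sum-cong-≗ {x = init f} init-f≗) (cong suc (toℕ-fromℕ n)) ⟩
    sum (λ (i : Fin n) → suc (toℕ i)) * suc n  ≈⟨ *-congʳ-≡ₘ (suc n) (∏-residue≡! n) ⟩
    n ! * suc n                                ≡⟨ *-comm (n !) (suc n) ⟩
    suc n !                                    ∎
    where
    f : Fin (suc n) → ℕ
    f i = suc (toℕ i)
    init-f≗ : ∀ i → init f i ≡ suc (toℕ i)
    init-f≗ i = cong suc (toℕ-inject₁ i)

  -- Only the square is needed: x ↦ x⁻¹ permutes the units, so (∏ x)² = ∏ x · x⁻¹ = 1,
  -- and the self-inverse residues ±1 need no separate treatment.
  wilson² : m ! * m ! ≡ₘ 1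
  wilson² = begin
    m ! * m !                                   ≈⟨ *-cong-≡ₘ (∏-residue≡! m) (∏-residue≡! m) ⟨
    sum residue * sum residue                   ≈⟨ *-congˡ-≡ₘ (sum residue) (sum-permute residue inv-permutation) ⟩
    sum residue * sum (λ i → residue (inv i))   ≈⟨ ∑-distrib-+ residue (λ i → residue (inv i)) ⟨
    sum (λ i → residue i * residue (inv i))     ≈⟨ sum-cong-≋ (λ i → proj₂ (inverseᶠ i)) ⟩
    sum (λ (_ : Fin m) → 1)                     ≈⟨ sum-replicate-zero m ⟩
    1                                           ∎

  square-complement : ∀ c i → c + i ≡ p → c * c ≡ₘ i * i
  square-complement c i c+i≡p = begin
    c * c                      ≈⟨ +-*-≡ₘ (c * c) (2 * i) ⟨
    c * c + 2 * i * p          ≡⟨ cong (λ q → c * c + 2 * i * q) c+i≡p ⟨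
    c * c + 2 * i * (c + i)    ≡⟨ expand c i ⟩
    i * i + (c + i) * (c + i)  ≡⟨ cong (λ q → i * i + q * q) c+i≡p ⟩
    i * i + p * p              ≈⟨ +-*-≡ₘ (i * i) p ⟩
    i * i                      ∎
    where
    expand : ∀ c i → c * c + 2 * i * (c + i) ≡ i * i + (c + i) * (c + i)
    expand = solve-∀

  factorial-reflection : ∀ j k → j + k ≡ m → (j ! * k !) * (j ! * k !) ≡ₘ 1
  factorial-reflection j zero j+0≡m = begin
    (j ! * 1) * (j ! * 1)  ≡⟨ cong (λ x → (x ! * 1) * (x ! * 1)) (trans (sym (+-identityʳ j)) j+0≡m) ⟩
    (m ! * 1) * (m ! * 1)  ≡⟨ cong₂ _*_ (*-identityʳ (m !)) (*-identityʳ (m !)) ⟩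
    m ! * m !              ≈⟨ wilson² ⟩
    1                      ∎
  factorial-reflection j (suc k) j+[1+k]≡m = begin
    (j ! * suc k !) * (j ! * suc k !)              ≡⟨ pull-out (j !) (k !) (suc k) ⟩
    (suc k * suc k) * ((j ! * k !) * (j ! * k !))  ≈⟨ *-congʳ-≡ₘ _ (square-complement (suc k) (suc j) [1+k]+[1+j]≡p) ⟩
    (suc j * suc j) * ((j ! * k !) * (j ! * k !))  ≡⟨ pull-out′ (j !) (k !) (suc j) ⟩
    (suc j ! * k !) * (suc j ! * k !)              ≈⟨ factorial-reflection (suc j) k [1+j]+k≡m ⟩
    1                                              ∎
    where
    pull-out : ∀ x y s → (x * (s * y)) * (x * (s * y)) ≡ (s * s) * ((x * y) * (x * y))
    pull-out = solve-∀
    pull-out′ : ∀ x y t → (t * t) * ((x * y) * (x * y)) ≡ ((t * x) * y) * ((t * x) * y)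
    pull-out′ = solve-∀
    [1+j]+k≡m : suc j + k ≡ m
    [1+j]+k≡m = trans (sym (+-suc j k)) j+[1+k]≡m
    [1+k]+[1+j]≡p : suc k + suc j ≡ p
    [1+k]+[1+j]≡p = cong suc (trans (+-comm k (suc j)) [1+j]+k≡m)

module PrimeProduct (m : ℕ) (prime : Prime (suc m)) where
  open import Data.Nat.Base
  open import Data.Nat.Properties using (*-comm; *-identityˡ; *-identityʳ; +-comm; +-identityʳ; ≤-refl; <⇒≱; <⇒≤)
  open import Data.Nat.DivMod using (m≡m%n+[m/n]*n)
  open import Data.Nat.Divisibility using (_∣_; _∣?_; ∣⇒≤; ∣m∣n⇒∣m+n; ∣m+n∣m⇒∣n; ∣-refl; _∣0)
  open import Data.Nat.Tactic.RingSolver using (solve-∀)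
  open import Data.Empty using (⊥-elim)
  open import Relation.Nullary using (¬_; Dec; yes; no)
  open Congruence (suc m)
  open Wilson m prime using (wilson²)

  private
    p : ℕ
    p = suc m

    P : ℕ → ℕ
    P = prodCoprime p

  prodCoprime-suc-∣ : ∀ {k} → p ∣ k → P (suc k) ≡ P k
  prodCoprime-suc-∣ {k} p∣k with p ∣? k
  ... | yes _   = refl
  ... | no  p∤k = ⊥-elim (p∤k p∣k)

  prodCoprime-suc-∤ : ∀ {k} → ¬ p ∣ k → P (suc k) ≡ P k * k
  prodCoprime-suc-∤ {k} p∤k with p ∣? k
  ... | yes p∣k = ⊥-elim (p∤k p∣k)
  ... | no  _   = refl

  prodCoprime-below : ∀ j → j < p → P (suc j) ≡ j !
  prodCoprime-below zero    _       = prodCoprime-suc-∣ (p ∣0)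
  prodCoprime-below (suc j) 1+j<p = begin
    P (suc (suc j))   ≡⟨ prodCoprime-suc-∤ (λ p∣1+j → <⇒≱ 1+j<p (∣⇒≤ p∣1+j)) ⟩
    P (suc j) * suc j ≡⟨ cong (_* suc j) (prodCoprime-below j (<⇒≤ 1+j<p)) ⟩
    j ! * suc j       ≡⟨ *-comm (j !) (suc j) ⟩
    suc j !           ∎
    where open ≡-Reasoning

  prodCoprime-+p : ∀ n → P (n + p) ≡ₘ P n * m !
  prodCoprime-+p zero = ≡⇒≡ₘ (trans (prodCoprime-below m ≤-refl) (sym (*-identityˡ (m !))))
  prodCoprime-+p (suc n) = step (p ∣? n)
    where
    open ≡ₘ-Reasoning
    step : Dec (p ∣ n) → P (suc n + p) ≡ₘ P (suc n) * m !
    step (yes p∣n) = begin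
      P (suc (n + p))  ≡⟨ prodCoprime-suc-∣ (∣m∣n⇒∣m+n p∣n ∣-refl) ⟩
      P (n + p)        ≈⟨ prodCoprime-+p n ⟩
      P n * m !        ≡⟨ cong (_* m !) (prodCoprime-suc-∣ p∣n) ⟨
      P (suc n) * m !  ∎
    step (no p∤n) = begin
      P (suc (n + p))      ≡⟨ prodCoprime-suc-∤ (λ p∣n+p → p∤n (∣m+n∣m⇒∣n (subst (p ∣_) (+-comm n p) p∣n+p) ∣-refl)) ⟩
      P (n + p) * (n + p)  ≈⟨ *-cong-≡ₘ (prodCoprime-+p n) (+-≡ₘ n) ⟩
      P n * m ! * n        ≡⟨ swap (P n) (m !) n ⟩
      P n * n * m !        ≡⟨ cong (_* m !) (prodCoprime-suc-∤ p∤n) ⟨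
      P (suc n) * m !      ∎
      where
      swap : ∀ x y z → x * y * z ≡ x * z * y
      swap = solve-∀

  prodCoprime-periodic² : ∀ r q → P (r + q * p) * P (r + q * p) ≡ₘ P r * P r
  prodCoprime-periodic² r zero = ≡⇒≡ₘ (cong (λ x → P x * P x) (+-identityʳ r))
  prodCoprime-periodic² r (suc q) = begin
    P (r + (p + q * p)) * P (r + (p + q * p))    ≡⟨ cong (λ x → P x * P x) (shift r p (q * p)) ⟩
    P (r + q * p + p) * P (r + q * p + p)        ≈⟨ *-cong-≡ₘ (prodCoprime-+p (r + q * p)) (prodCoprime-+p (r + q * p)) ⟩
    (P (r + q * p) * m !) * (P (r + q * p) * m !)  ≡⟨ regroup (P (r + q * p)) (m !) ⟩
    (P (r + q * p) * P (r + q * p)) * (m ! * m !)  ≈⟨ *-cong-≡ₘ (prodCoprime-periodic² r q) wilson² ⟩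
    P r * P r * 1                                ≡⟨ *-identityʳ (P r * P r) ⟩
    P r * P r                                    ∎
    where
    open ≡ₘ-Reasoning
    shift : ∀ r p s → r + (p + s) ≡ r + s + p
    shift = solve-∀
    regroup : ∀ x y → (x * y) * (x * y) ≡ (x * x) * (y * y)
    regroup = solve-∀

  prodCoprime-mod² : ∀ N → P N * P N ≡ₘ P (N % p) * P (N % p)
  prodCoprime-mod² N = begin
    P N * P N                                    ≡⟨ cong (λ x → P x * P x) (m≡m%n+[m/n]*n N p) ⟩
    P (N % p + N / p * p) * P (N % p + N / p * p) ≈⟨ prodCoprime-periodic² (N % p) (N / p) ⟩
    P (N % p) * P (N % p)                        ∎
    where open ≡ₘ-Reasoning

module GammaPower where
  open import Data.Integer.Base using (+_; -_; 1ℤ; _*_; _^_)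
  open import Data.Integer.Properties using (pos-*; *-identityˡ; +-*-commutativeSemiring)
  open import Data.Integer.Tactic.RingSolver using (solve-∀)
  open import Algebra.Properties.CommutativeSemiring.Exp +-*-commutativeSemiring using (^-distrib-*)

  sign² : ∀ N → (- 1ℤ) ^ N * (- 1ℤ) ^ N ≡ 1ℤ
  sign² zero    = refl
  sign² (suc N) = trans (flip-sign ((- 1ℤ) ^ N)) (sign² N)
    where
    flip-sign : ∀ s → (- 1ℤ * s) * (- 1ℤ * s) ≡ s * s
    flip-sign = solve-∀

  pos-^ : ∀ x n → + (x ℕ.^ n) ≡ (+ x) ^ n
  pos-^ x zero    = refl
  pos-^ x (suc n) = trans (pos-* x (x ℕ.^ n)) (cong (+ x *_) (pos-^ x n))

  Γp^6 : ∀ p N → Γp p N ^ 6 ≡ + (prodCoprime p N ℕ.^ 6)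
  Γp^6 p N = begin
    (s * + x) ^ 6            ≡⟨ ^-distrib-* s (+ x) 6 ⟩
    s ^ 6 * (+ x) ^ 6        ≡⟨ cong (_* (+ x) ^ 6) (sixth-power s) ⟩
    (s * s) * ((s * s) * (s * s)) * (+ x) ^ 6  ≡⟨ cong (λ t → t * (t * t) * (+ x) ^ 6) (sign² N) ⟩
    1ℤ * (+ x) ^ 6           ≡⟨ *-identityˡ ((+ x) ^ 6) ⟩
    (+ x) ^ 6                ≡⟨ pos-^ x 6 ⟨
    + (x ℕ.^ 6)              ∎
    where
    open ≡-Reasoning
    s = (- 1ℤ) ^ N
    x = prodCoprime p N
    sixth-power : ∀ s → s * (s * (s * (s * (s * (s * 1ℤ))))) ≡ (s * s) * ((s * s) * (s * s))
    sixth-power = solve-∀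

module Rationals where
  open import Data.Integer.Base using (ℤ; +_)
  open import Data.Rational.Base
  open import Data.Rational.Properties
    using (_≟_; toℚᵘ-injective; toℚᵘ-cong; toℚᵘ-fromℚᵘ; toℚᵘ-homo-*; toℚᵘ-homo-+; toℚᵘ-homo‿-;
           *-comm; *-identityˡ; *-identityʳ; +-identityʳ)
  open import Data.Nat.Divisibility using (_∣_; divides)
  open import Data.Nat.Coprimality as Coprime using (coprime-divisor)
  import Data.Rational.Unnormalised.Base as ℚᵘ
  import Data.Rational.Unnormalised.Properties as ℚᵘ
  open import Data.Integer.Tactic.RingSolver using (solve-∀)
  open import Data.Rational.Solver using (module +-*-Solver)
  open +-*-Solver using (solve; _:+_; _:*_; :-_; _:=_; con)
  open import Relation.Nullary using (yes; no)
  open import Data.Empty using (⊥-elim)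

  fromℤ : ℤ → ℚ
  fromℤ z = z / 1

  private
    toℚᵘ-fromℤ : ∀ z → toℚᵘ (fromℤ z) ℚᵘ.≃ ℚᵘ.mkℚᵘ z 0
    toℚᵘ-fromℤ z = toℚᵘ-fromℚᵘ (ℚᵘ.mkℚᵘ z 0)

  fromℤ-homo-* : ∀ a b → fromℤ (a ℤ.* b) ≡ fromℤ a * fromℤ b
  fromℤ-homo-* a b = toℚᵘ-injective (begin
    toℚᵘ (fromℤ (a ℤ.* b))              ≈⟨ toℚᵘ-fromℤ (a ℤ.* b) ⟩
    ℚᵘ.mkℚᵘ a 0 ℚᵘ.* ℚᵘ.mkℚᵘ b 0        ≈⟨ ℚᵘ.*-cong (toℚᵘ-fromℤ a) (toℚᵘ-fromℤ b) ⟨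
    toℚᵘ (fromℤ a) ℚᵘ.* toℚᵘ (fromℤ b)  ≈⟨ toℚᵘ-homo-* (fromℤ a) (fromℤ b) ⟨
    toℚᵘ (fromℤ a * fromℤ b)            ∎)
    where open ℚᵘ.≃-Reasoning

  fromℤ-homo-+ : ∀ a b → fromℤ (a ℤ.+ b) ≡ fromℤ a + fromℤ b
  fromℤ-homo-+ a b = toℚᵘ-injective (begin
    toℚᵘ (fromℤ (a ℤ.+ b))              ≈⟨ toℚᵘ-fromℤ (a ℤ.+ b) ⟩
    ℚᵘ.mkℚᵘ (a ℤ.+ b) 0                 ≈⟨ ℚᵘ.*≡* (unit-denominators a b) ⟩
    ℚᵘ.mkℚᵘ a 0 ℚᵘ.+ ℚᵘ.mkℚᵘ b 0        ≈⟨ ℚᵘ.+-cong (toℚᵘ-fromℤ a) (toℚᵘ-fromℤ b) ⟨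
    toℚᵘ (fromℤ a) ℚᵘ.+ toℚᵘ (fromℤ b)  ≈⟨ toℚᵘ-homo-+ (fromℤ a) (fromℤ b) ⟨
    toℚᵘ (fromℤ a + fromℤ b)            ∎)
    where
    open ℚᵘ.≃-Reasoning
    unit-denominators : ∀ a b → (a ℤ.+ b) ℤ.* (ℤ.1ℤ ℤ.* ℤ.1ℤ) ≡ (a ℤ.* ℤ.1ℤ ℤ.+ b ℤ.* ℤ.1ℤ) ℤ.* ℤ.1ℤ
    unit-denominators = solve-∀

  fromℤ-homo‿- : ∀ a → fromℤ (ℤ.- a) ≡ - fromℤ a
  fromℤ-homo‿- a = toℚᵘ-injective (begin
    toℚᵘ (fromℤ (ℤ.- a))    ≈⟨ toℚᵘ-fromℤ (ℤ.- a) ⟩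
    ℚᵘ.- ℚᵘ.mkℚᵘ a 0        ≈⟨ ℚᵘ.-‿cong (toℚᵘ-fromℤ a) ⟨
    ℚᵘ.- toℚᵘ (fromℤ a)     ≈⟨ toℚᵘ-homo‿- (fromℤ a) ⟨
    toℚᵘ (- fromℤ a)        ∎)
    where open ℚᵘ.≃-Reasoning

  ι-homo-* : ∀ m n → ι (m ℕ.* n) ≡ ι m * ι n
  ι-homo-* m n = trans (cong fromℤ (ℤ.pos-* m n)) (fromℤ-homo-* (+ m) (+ n))

  ι-homo-+ : ∀ m n → ι (m ℕ.+ n) ≡ ι m + ι n
  ι-homo-+ m n = trans (cong fromℤ (ℤ.pos-+ m n)) (fromℤ-homo-+ (+ m) (+ n))

  ι-injective : ∀ {m n} → ι m ≡ ι n → m ≡ n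
  ι-injective {m} {n} ιm≡ιn = ℤ.+-injective (begin
    + m           ≡⟨ ℤ.*-identityʳ (+ m) ⟨
    + m ℤ.* + 1   ≡⟨ ℚᵘ.drop-*≡* ιm≃ιn ⟩
    + n ℤ.* + 1   ≡⟨ ℤ.*-identityʳ (+ n) ⟩
    + n           ∎)
    where
    open ≡-Reasoning
    ιm≃ιn : ℚᵘ.mkℚᵘ (+ m) 0 ℚᵘ.≃ ℚᵘ.mkℚᵘ (+ n) 0
    ιm≃ιn = ℚᵘ.≃-trans (ℚᵘ.≃-sym (toℚᵘ-fromℤ (+ m))) (ℚᵘ.≃-trans (toℚᵘ-cong ιm≡ιn) (toℚᵘ-fromℤ (+ n)))

  1/n*n≡1 : ∀ m → (+ 1 / suc m) * ι (suc m) ≡ 1ℚ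
  1/n*n≡1 m = toℚᵘ-injective (begin
    toℚᵘ (+ 1 / suc m * ι (suc m))             ≈⟨ toℚᵘ-homo-* (+ 1 / suc m) (ι (suc m)) ⟩
    toℚᵘ (+ 1 / suc m) ℚᵘ.* toℚᵘ (ι (suc m))   ≈⟨ ℚᵘ.*-cong (toℚᵘ-fromℚᵘ (ℚᵘ.mkℚᵘ (+ 1) m)) (toℚᵘ-fromℤ (+ suc m)) ⟩
    ℚᵘ.mkℚᵘ (+ 1) m ℚᵘ.* ℚᵘ.mkℚᵘ (+ suc m) 0   ≈⟨ ℚᵘ.*≡* cross ⟩
    toℚᵘ 1ℚ                                    ∎)
    where
    open ℚᵘ.≃-Reasoning
    cross : ℤ.1ℤ ℤ.* + suc m ℤ.* ℤ.1ℤ ≡ ℤ.1ℤ ℤ.* + suc (m ℕ.* 1)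
    cross = trans (ℤ.*-identityʳ _) (cong (λ k → ℤ.1ℤ ℤ.* + suc k) (sym (ℕ.*-identityʳ m)))

  cross-multiply : ∀ q b X → q * ι b ≡ fromℤ X → ↥ q ℤ.* + b ≡ X ℤ.* ↧ q
  cross-multiply q@(mkℚ n d _) b X qb≡X = begin
    n ℤ.* + b                   ≡⟨ ℤ.*-identityʳ (n ℤ.* + b) ⟨
    n ℤ.* + b ℤ.* ℤ.1ℤ          ≡⟨ ℚᵘ.drop-*≡* qb≃X ⟩
    X ℤ.* + suc (d ℕ.* 1)       ≡⟨ cong (λ k → X ℤ.* + suc k) (ℕ.*-identityʳ d) ⟩
    X ℤ.* + suc d               ∎
    where
    open ≡-Reasoning
    qb≃X : ℚᵘ.mkℚᵘ n d ℚᵘ.* ℚᵘ.mkℚᵘ (+ b) 0 ℚᵘ.≃ ℚᵘ.mkℚᵘ X 0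
    qb≃X = ℚᵘ.≃-trans (ℚᵘ.*-congˡ {ℚᵘ.mkℚᵘ n d} (ℚᵘ.≃-sym (toℚᵘ-fromℤ (+ b))))
             (ℚᵘ.≃-trans (ℚᵘ.≃-sym (toℚᵘ-homo-* q (ι b)))
             (ℚᵘ.≃-trans (toℚᵘ-cong qb≡X) (toℚᵘ-fromℤ X)))

  denominator-divides : ∀ q b X → q * ι b ≡ fromℤ X → ↧ₙ q ∣ b
  denominator-divides q@(mkℚ n d coprime) b X qb≡X =
    coprime-divisor (Coprime.sym (Coprime.recompute coprime)) (divides ℤ.∣ X ∣ (begin
      ℤ.∣ n ∣ ℕ.* b          ≡⟨ ℤ.abs-* n (+ b) ⟨
      ℤ.∣ n ℤ.* + b ∣        ≡⟨ cong ℤ.∣_∣ (cross-multiply q b X qb≡X) ⟩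
      ℤ.∣ X ℤ.* + suc d ∣    ≡⟨ ℤ.abs-* X (+ suc d) ⟩
      ℤ.∣ X ∣ ℕ.* suc d      ∎))
    where open ≡-Reasoning

  ÷′-≢0 : ∀ x y (y≢0 : y ≢ 0ℚ) → x ÷' y ≡ x * (1/ y) {{≢-nonZero y≢0}}
  ÷′-≢0 x y y≢0 with y ≟ 0ℚ
  ... | yes y≡0 = ⊥-elim (y≢0 y≡0)
  ... | no  _   = refl

  sumFrom1-cong : ∀ {f g} → (∀ i → f i ≡ g i) → ∀ n → sumFrom1 f n ≡ sumFrom1 g n
  sumFrom1-cong f≗g zero    = refl
  sumFrom1-cong f≗g (suc n) = cong₂ _+_ (sumFrom1-cong f≗g n) (f≗g (suc n))

  poch-+ : ∀ x m n → poch x (m ℕ.+ n) ≡ poch x m * poch (x + ι m) n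
  poch-+ x m zero = begin
    poch x (m ℕ.+ 0)  ≡⟨ cong (poch x) (ℕ.+-identityʳ m) ⟩
    poch x m          ≡⟨ *-identityʳ (poch x m) ⟨
    poch x m * 1ℚ     ∎
    where open ≡-Reasoning
  poch-+ x m (suc n) = begin
    poch x (m ℕ.+ suc n)                                   ≡⟨ cong (poch x) (ℕ.+-suc m n) ⟩
    poch x (m ℕ.+ n) * (x + ι (m ℕ.+ n))                   ≡⟨ cong₂ (λ a b → a * (x + b)) (poch-+ x m n) (ι-homo-+ m n) ⟩
    poch x m * poch (x + ι m) n * (x + (ι m + ι n))        ≡⟨ regroup (poch x m) (poch (x + ι m) n) x (ι m) (ι n) ⟩
    poch x m * (poch (x + ι m) n * (x + ι m + ι n))        ∎
    where
    open ≡-Reasoning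
    regroup : ∀ a b x y z → a * b * (x + (y + z)) ≡ a * (b * (x + y + z))
    regroup = solve 5 (λ a b x y z → a :* b :* (x :+ (y :+ z)) := a :* (b :* (x :+ y :+ z))) refl

  poch-suc : ∀ x n → poch x (suc n) ≡ x * poch (x + 1ℚ) n
  poch-suc x n = begin
    poch x (1 ℕ.+ n)                      ≡⟨ poch-+ x 1 n ⟩
    1ℚ * (x + 0ℚ) * poch (x + 1ℚ) n       ≡⟨ cong (_* poch (x + 1ℚ) n) (trans (*-identityˡ (x + 0ℚ)) (+-identityʳ x)) ⟩
    x * poch (x + 1ℚ) n                   ∎
    where open ≡-Reasoning

  poch-1 : ∀ n → poch 1ℚ n ≡ ι (n !)
  poch-1 zero    = refl
  poch-1 (suc n) = begin
    poch 1ℚ n * (1ℚ + ι n)   ≡⟨ cong₂ _*_ (sym (poch-1 n)) (ι-homo-+ 1 n) ⟨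
    ι (n !) * ι (suc n)      ≡⟨ *-comm (ι (n !)) (ι (suc n)) ⟩
    ι (suc n) * ι (n !)      ≡⟨ ι-homo-* (suc n) (n !) ⟨
    ι (suc n !)              ∎
    where open ≡-Reasoning

  poch-neg² : ∀ n → poch (- ι n) n * poch (- ι n) n ≡ ι (n !) * ι (n !)
  poch-neg² zero    = refl
  poch-neg² (suc n) = begin
    poch (- s) (suc n) * poch (- s) (suc n)          ≡⟨ cong (λ y → y * y) (poch-suc (- s) n) ⟩
    (- s * poch (- s + 1ℚ) n) * (- s * poch (- s + 1ℚ) n)  ≡⟨ cong (λ z → (- s * poch z n) * (- s * poch z n)) -s+1≡-n ⟩
    (- s * Z) * (- s * Z)                            ≡⟨ neg-square s Z ⟩
    s * s * (Z * Z)                                  ≡⟨ cong (s * s *_) (poch-neg² n) ⟩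
    s * s * (ι (n !) * ι (n !))                      ≡⟨ regroup s (ι (n !)) ⟩
    (s * ι (n !)) * (s * ι (n !))                    ≡⟨ cong (λ y → y * y) (ι-homo-* (suc n) (n !)) ⟨
    ι (suc n !) * ι (suc n !)                        ∎
    where
    open ≡-Reasoning
    s = ι (suc n)
    Z = poch (- ι n) n
    -s+1≡-n : - s + 1ℚ ≡ - ι n
    -s+1≡-n = trans (cong (λ y → - y + 1ℚ) (ι-homo-+ 1 n)) (solve 1 (λ y → :- (con 1ℚ :+ y) :+ con 1ℚ := :- y) refl (ι n))
    neg-square : ∀ s z → (- s * z) * (- s * z) ≡ s * s * (z * z)
    neg-square = solve 2 (λ s z → (:- s :* z) :* (:- s :* z) := s :* s :* (z :* z)) refl
    regroup : ∀ s f → s * s * (f * f) ≡ (s * f) * (s * f)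
    regroup = solve 2 (λ s f → s :* s :* (f :* f) := (s :* f) :* (s :* f)) refl

module Localisation (p : ℕ) (prime : Prime p) where
  open import Data.Integer.Base using (ℤ; +_)
  open import Data.Rational.Base
  open import Data.Rational.Properties
    using (*-comm; *-assoc; *-identityʳ; *-zeroʳ; +-identityˡ; +-identityʳ; +-inverseʳ; *-distribˡ-+; neg-distribˡ-*; neg-distribʳ-*)
  open import Data.Nat.Divisibility using (_∣_; divides; ∣1⇒≡1; ∣⇒≤; 1∣_; ∣-trans; m∣m*n; *-monoʳ-∣; *-cancelˡ-∣)
  open import Data.Nat.Tactic.RingSolver using () renaming (solve-∀ to ℕ-solve-∀)
  open import Data.Integer.Tactic.RingSolver using () renaming (solve-∀ to ℤ-solve-∀)
  open import Data.Rational.Solver using (module +-*-Solver)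
  open +-*-Solver using (solve; _:+_; _:*_; _:-_; :-_; _:=_)
  open import Data.Sum.Base using ([_,_]′; inj₁; inj₂)
  open import Relation.Nullary using (¬_; yes; no)
  open import Function.Base using (_∘_)
  open import Data.Empty using (⊥-elim)
  open Rationals

  instance
    p-nonZero : ℕ.NonZero p
    p-nonZero = prime⇒nonZero prime

  open Congruence p using (_≡ₘ_; mod-≡)

  p∤1 : ¬ p ∣ 1
  p∤1 p∣1 = ℕ.nonTrivial⇒≢1 {{prime⇒nonTrivial prime}} (∣1⇒≡1 p∣1)

  p∤* : ∀ {m n} → ¬ p ∣ m → ¬ p ∣ n → ¬ p ∣ m ℕ.* n
  p∤* {m} {n} p∤m p∤n p∣mn = [ p∤m , p∤n ]′ (euclidsLemma m n prime p∣mn)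

  p∤! : ∀ n → n ℕ.< p → ¬ p ∣ n !
  p∤! zero    _     = p∤1
  p∤! (suc n) 1+n<p = p∤* (λ p∣1+n → ℕ.<⇒≱ 1+n<p (∣⇒≤ p∣1+n)) (p∤! n (ℕ.<⇒≤ 1+n<p))

  record PIntegral (q : ℚ) : Set where
    constructor integral
    field
      numer        : ℤ
      denom        : ℕ
      p∤denom      : ¬ p ∣ denom
      *denom≡numer : q * ι denom ≡ fromℤ numer

  fromℤ-integral : ∀ z → PIntegral (fromℤ z)
  fromℤ-integral z = integral z 1 p∤1 (*-identityʳ (fromℤ z))

  ι-integral : ∀ n → PIntegral (ι n)
  ι-integral n = fromℤ-integral (+ n)

  +-integral : ∀ {q r} → PIntegral q → PIntegral r → PIntegral (q + r)
  +-integral {q} {r} (integral a b p∤b qb≡a) (integral c d p∤d rd≡c) =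
    integral (a ℤ.* + d ℤ.+ c ℤ.* + b) (b ℕ.* d) (p∤* p∤b p∤d) (begin
      (q + r) * ι (b ℕ.* d)                      ≡⟨ cong ((q + r) *_) (ι-homo-* b d) ⟩
      (q + r) * (ι b * ι d)                      ≡⟨ cross q r (ι b) (ι d) ⟩
      q * ι b * ι d + r * ι d * ι b              ≡⟨ cong₂ (λ x y → x * ι d + y * ι b) qb≡a rd≡c ⟩
      fromℤ a * ι d + fromℤ c * ι b              ≡⟨ cong₂ _+_ (fromℤ-homo-* a (+ d)) (fromℤ-homo-* c (+ b)) ⟨
      fromℤ (a ℤ.* + d) + fromℤ (c ℤ.* + b)      ≡⟨ fromℤ-homo-+ (a ℤ.* + d) (c ℤ.* + b) ⟨
      fromℤ (a ℤ.* + d ℤ.+ c ℤ.* + b)            ∎)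
    where
    open ≡-Reasoning
    cross : ∀ q r b d → (q + r) * (b * d) ≡ q * b * d + r * d * b
    cross = solve 4 (λ q r b d → (q :+ r) :* (b :* d) := q :* b :* d :+ r :* d :* b) refl

  *-integral : ∀ {q r} → PIntegral q → PIntegral r → PIntegral (q * r)
  *-integral {q} {r} (integral a b p∤b qb≡a) (integral c d p∤d rd≡c) =
    integral (a ℤ.* c) (b ℕ.* d) (p∤* p∤b p∤d) (begin
      q * r * ι (b ℕ.* d)        ≡⟨ cong (q * r *_) (ι-homo-* b d) ⟩
      q * r * (ι b * ι d)        ≡⟨ *-interchange q r (ι b) (ι d) ⟩
      (q * ι b) * (r * ι d)      ≡⟨ cong₂ _*_ qb≡a rd≡c ⟩
      fromℤ a * fromℤ c          ≡⟨ fromℤ-homo-* a c ⟨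
      fromℤ (a ℤ.* c)            ∎)
    where
    open ≡-Reasoning
    *-interchange : ∀ q r b d → q * r * (b * d) ≡ (q * b) * (r * d)
    *-interchange = solve 4 (λ q r b d → q :* r :* (b :* d) := (q :* b) :* (r :* d)) refl

  -‿integral : ∀ {q} → PIntegral q → PIntegral (- q)
  -‿integral {q} (integral a b p∤b qb≡a) = integral (ℤ.- a) b p∤b (begin
    - q * ι b       ≡⟨ neg-distribˡ-* q (ι b) ⟨
    - (q * ι b)     ≡⟨ cong -_ qb≡a ⟩
    - fromℤ a       ≡⟨ fromℤ-homo‿- a ⟨
    fromℤ (ℤ.- a)   ∎)
    where open ≡-Reasoning

  1/n-integral : ∀ m → ¬ p ∣ suc m → PIntegral (+ 1 / suc m)
  1/n-integral m p∤1+m = integral (+ 1) (suc m) p∤1+m (1/n*n≡1 m)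

  infix 4 _≈_
  -- Congruence modulo p in ℤ₍ₚ₎. It relates p-integral rationals only, hence a partial setoid.
  record _≈_ (q r : ℚ) : Set where
    constructor ≈-intro
    field
      integralˡ         : PIntegral q
      integralʳ         : PIntegral r
      quotient          : ℚ
      integral-quotient : PIntegral quotient
      -≡p*quotient      : q - r ≡ ι p * quotient

  ≈-refl : ∀ {q} → PIntegral q → q ≈ q
  ≈-refl {q} q∈ℤₚ = ≈-intro q∈ℤₚ q∈ℤₚ 0ℚ (ι-integral 0) (trans (+-inverseʳ q) (sym (*-zeroʳ (ι p))))

  ≈-sym : ∀ {q r} → q ≈ r → r ≈ q
  ≈-sym {q} {r} (≈-intro q∈ℤₚ r∈ℤₚ t t∈ℤₚ q-r≡pt) = ≈-intro r∈ℤₚ q∈ℤₚ (- t) (-‿integral t∈ℤₚ) (begin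
    r - q           ≡⟨ solve 2 (λ q r → r :- q := :- (q :- r)) refl q r ⟩
    - (q - r)       ≡⟨ cong -_ q-r≡pt ⟩
    - (ι p * t)     ≡⟨ neg-distribʳ-* (ι p) t ⟩
    ι p * - t       ∎)
    where open ≡-Reasoning

  ≈-trans : ∀ {q r s} → q ≈ r → r ≈ s → q ≈ s
  ≈-trans {q} {r} {s} (≈-intro q∈ℤₚ _ t t∈ℤₚ q-r≡pt) (≈-intro _ s∈ℤₚ u u∈ℤₚ r-s≡pu) =
    ≈-intro q∈ℤₚ s∈ℤₚ (t + u) (+-integral t∈ℤₚ u∈ℤₚ) (begin
      q - s                  ≡⟨ solve 3 (λ q r s → q :- s := (q :- r) :+ (r :- s)) refl q r s ⟩
      (q - r) + (r - s)      ≡⟨ cong₂ _+_ q-r≡pt r-s≡pu ⟩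
      ι p * t + ι p * u      ≡⟨ *-distribˡ-+ (ι p) t u ⟨
      ι p * (t + u)          ∎)
    where open ≡-Reasoning

  ≡⇒≈ : ∀ {q r} → PIntegral q → q ≡ r → q ≈ r
  ≡⇒≈ q∈ℤₚ refl = ≈-refl q∈ℤₚ

  +-cong : ∀ {q q′ r r′} → q ≈ q′ → r ≈ r′ → q + r ≈ q′ + r′
  +-cong {q} {q′} {r} {r′} (≈-intro q∈ℤₚ q′∈ℤₚ t t∈ℤₚ q-q′≡pt)
                           (≈-intro r∈ℤₚ r′∈ℤₚ u u∈ℤₚ r-r′≡pu) =
    ≈-intro (+-integral q∈ℤₚ r∈ℤₚ) (+-integral q′∈ℤₚ r′∈ℤₚ) (t + u) (+-integral t∈ℤₚ u∈ℤₚ) (begin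
      (q + r) - (q′ + r′)    ≡⟨ solve 4 (λ q q′ r r′ → (q :+ r) :- (q′ :+ r′) := (q :- q′) :+ (r :- r′)) refl q q′ r r′ ⟩
      (q - q′) + (r - r′)    ≡⟨ cong₂ _+_ q-q′≡pt r-r′≡pu ⟩
      ι p * t + ι p * u      ≡⟨ *-distribˡ-+ (ι p) t u ⟨
      ι p * (t + u)          ∎)
    where open ≡-Reasoning

  -‿cong : ∀ {q q′} → q ≈ q′ → - q ≈ - q′
  -‿cong {q} {q′} (≈-intro q∈ℤₚ q′∈ℤₚ t t∈ℤₚ q-q′≡pt) =
    ≈-intro (-‿integral q∈ℤₚ) (-‿integral q′∈ℤₚ) (- t) (-‿integral t∈ℤₚ) (begin
      - q - - q′       ≡⟨ solve 2 (λ q q′ → :- q :- :- q′ := :- (q :- q′)) refl q q′ ⟩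
      - (q - q′)       ≡⟨ cong -_ q-q′≡pt ⟩
      - (ι p * t)      ≡⟨ neg-distribʳ-* (ι p) t ⟩
      ι p * - t        ∎)
    where open ≡-Reasoning

  *-cong : ∀ {q q′ r r′} → q ≈ q′ → r ≈ r′ → q * r ≈ q′ * r′
  *-cong {q} {q′} {r} {r′} (≈-intro q∈ℤₚ q′∈ℤₚ t t∈ℤₚ q-q′≡pt)
                           (≈-intro r∈ℤₚ r′∈ℤₚ u u∈ℤₚ r-r′≡pu) =
    ≈-intro (*-integral q∈ℤₚ r∈ℤₚ) (*-integral q′∈ℤₚ r′∈ℤₚ) (q * u + r′ * t)
      (+-integral (*-integral q∈ℤₚ u∈ℤₚ) (*-integral r′∈ℤₚ t∈ℤₚ)) (begin
      q * r - q′ * r′                    ≡⟨ split q q′ r r′ ⟩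
      q * (r - r′) + r′ * (q - q′)       ≡⟨ cong₂ (λ x y → q * x + r′ * y) r-r′≡pu q-q′≡pt ⟩
      q * (ι p * u) + r′ * (ι p * t)     ≡⟨ factor (ι p) q r′ t u ⟩
      ι p * (q * u + r′ * t)             ∎)
    where
    open ≡-Reasoning
    split : ∀ q q′ r r′ → q * r - q′ * r′ ≡ q * (r - r′) + r′ * (q - q′)
    split = solve 4 (λ q q′ r r′ → q :* r :- q′ :* r′ := q :* (r :- r′) :+ r′ :* (q :- q′)) refl
    factor : ∀ P q r′ t u → q * (P * u) + r′ * (P * t) ≡ P * (q * u + r′ * t)
    factor = solve 5 (λ P q r′ t u → q :* (P :* u) :+ r′ :* (P :* t) := P :* (q :* u :+ r′ :* t)) refl

  ≈-isPartialEquivalence : IsPartialEquivalence _≈_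
  ≈-isPartialEquivalence = record { sym = ≈-sym ; trans = ≈-trans }

  ≈-partialSetoid : PartialSetoid 0ℓ 0ℓ
  ≈-partialSetoid = record { isPartialEquivalence = ≈-isPartialEquivalence }

  module ≈-Reasoning = Relation.Binary.Reasoning.PartialSetoid ≈-partialSetoid

  p*≈0 : ∀ {x} → PIntegral x → ι p * x ≈ 0ℚ
  p*≈0 {x} x∈ℤₚ = ≈-intro (*-integral (ι-integral p) x∈ℤₚ) (ι-integral 0) x x∈ℤₚ (+-identityʳ (ι p * x))

  +*p≈ : ∀ r k → ι (r ℕ.+ k ℕ.* p) ≈ ι r
  +*p≈ r k = ≈-intro (ι-integral (r ℕ.+ k ℕ.* p)) (ι-integral r) (ι k) (ι-integral k) (begin
    ι (r ℕ.+ k ℕ.* p) - ι r     ≡⟨ cong (_- ι r) (trans (ι-homo-+ r (k ℕ.* p)) (cong (_+_ (ι r)) (ι-homo-* k p))) ⟩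
    ι r + ι k * ι p - ι r       ≡⟨ solve 3 (λ r k P → r :+ k :* P :- r := P :* k) refl (ι r) (ι k) (ι p) ⟩
    ι p * ι k                   ∎)
    where open ≡-Reasoning

  ≡ₘ⇒≈ : ∀ {x y} → x ≡ₘ y → ι x ≈ ι y
  ≡ₘ⇒≈ {x} {y} (mod-≡ x%p≡y%p) = begin
    ι x                            ≡⟨ cong ι (ℕ.m≡m%n+[m/n]*n x p) ⟩
    ι (x ℕ.% p ℕ.+ x ℕ./ p ℕ.* p)  ≈⟨ +*p≈ (x ℕ.% p) (x ℕ./ p) ⟩
    ι (x ℕ.% p)                    ≡⟨ cong ι x%p≡y%p ⟩
    ι (y ℕ.% p)                    ≈⟨ +*p≈ (y ℕ.% p) (y ℕ./ p) ⟨
    ι (y ℕ.% p ℕ.+ y ℕ./ p ℕ.* p)  ≡⟨ cong ι (ℕ.m≡m%n+[m/n]*n y p) ⟨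
    ι y                            ∎
    where open ≈-Reasoning

  poch-cong : ∀ {x y} → x ≈ y → ∀ n → poch x n ≈ poch y n
  poch-cong x≈y zero    = ≈-refl (ι-integral 1)
  poch-cong x≈y (suc n) = *-cong (poch-cong x≈y n) (+-cong x≈y (≈-refl (ι-integral n)))

  sumFrom1-≈0 : ∀ {f} n → (∀ i → 0 ℕ.< i → i ℕ.≤ n → f i ≈ 0ℚ) → sumFrom1 f n ≈ 0ℚ
  sumFrom1-≈0 zero    _   = ≈-refl (ι-integral 0)
  sumFrom1-≈0 (suc n) f≈0 =
    +-cong (sumFrom1-≈0 n (λ i 0<i i≤n → f≈0 i 0<i (ℕ.m≤n⇒m≤1+n i≤n))) (f≈0 (suc n) ℕ.z<s ℕ.≤-refl)

  sumFrom1-single : ∀ {f} j n → 0 ℕ.< j → j ℕ.≤ n → PIntegral (f j) →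
                    (∀ i → 0 ℕ.< i → i ℕ.≤ n → i ≢ j → f i ≈ 0ℚ) → sumFrom1 f n ≈ f j
  sumFrom1-single j zero 0<j j≤0 _ _ = ⊥-elim (ℕ.<⇒≱ 0<j j≤0)
  sumFrom1-single {f} j (suc n) 0<j j≤1+n fj∈ℤₚ f≈0 with j ℕ.≟ suc n
  ... | yes refl = begin
    sumFrom1 f n + f j  ≈⟨ +-cong (sumFrom1-≈0 n below≈0) (≈-refl fj∈ℤₚ) ⟩
    0ℚ + f j            ≡⟨ +-identityˡ (f j) ⟩
    f j                 ∎
    where
    open ≈-Reasoning
    below≈0 : ∀ i → 0 ℕ.< i → i ℕ.≤ n → f i ≈ 0ℚ
    below≈0 i 0<i i≤n = f≈0 i 0<i (ℕ.m≤n⇒m≤1+n i≤n) (ℕ.<⇒≢ (ℕ.s≤s i≤n))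
  ... | no j≢1+n = begin
    sumFrom1 f n + f (suc n)  ≈⟨ +-cong (sumFrom1-single j n 0<j j≤n fj∈ℤₚ (λ i 0<i i≤n → f≈0 i 0<i (ℕ.m≤n⇒m≤1+n i≤n)))
                                         (f≈0 (suc n) ℕ.z<s ℕ.≤-refl (j≢1+n ∘ sym)) ⟩
    f j + 0ℚ                  ≡⟨ +-identityʳ (f j) ⟩
    f j                       ∎
    where
    open ≈-Reasoning
    j≤n : j ℕ.≤ n
    j≤n = ℕ.≤-pred (ℕ.≤∧≢⇒< j≤1+n j≢1+n)

  prime-power-divisor : ∀ {b} → ¬ p ∣ b → ∀ k {y} → p ℕ.^ k ∣ b ℕ.* y → p ℕ.^ k ∣ y
  prime-power-divisor p∤b zero {y} _ = 1∣ y
  prime-power-divisor {b} p∤b (suc k) {y} p^[1+k]∣by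
    with euclidsLemma b y prime (∣-trans (m∣m*n (p ℕ.^ k)) p^[1+k]∣by)
  ... | inj₁ p∣b = ⊥-elim (p∤b p∣b)
  ... | inj₂ (divides y′ refl) = subst (p ℕ.* p ℕ.^ k ∣_) (ℕ.*-comm p y′) (*-monoʳ-∣ p p^k∣y′)
    where
    pull-p : ∀ b y p → b ℕ.* (y ℕ.* p) ≡ p ℕ.* (b ℕ.* y)
    pull-p = ℕ-solve-∀
    p^k∣by′ : p ℕ.^ k ∣ b ℕ.* y′
    p^k∣by′ = *-cancelˡ-∣ p (subst (p ℕ.* p ℕ.^ k ∣_) (pull-p b y′ p) p^[1+k]∣by)
    p^k∣y′ : p ℕ.^ k ∣ y′
    p^k∣y′ = prime-power-divisor p∤b k p^k∣by′

  congZp-intro : ∀ m {q c s} → PIntegral s → q ≡ fromℤ c + ι (p ℕ.^ m) * s → CongZp p m q c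
  congZp-intro m {q@(mkℚ n d _)} {c} {s} (integral a b p∤b sb≡a) q≡c+pᵐs =
    (λ p∣d → p∤b (∣-trans p∣d (denominator-divides q b X qb≡X))) ,
    prime-power-divisor p∤b m (divides ℤ.∣ a ℤ.* + suc d ∣ (begin
      b ℕ.* ℤ.∣ n ℤ.- c ℤ.* + suc d ∣          ≡⟨ ℤ.abs-* (+ b) (n ℤ.- c ℤ.* + suc d) ⟨
      ℤ.∣ + b ℤ.* (n ℤ.- c ℤ.* + suc d) ∣      ≡⟨ cong ℤ.∣_∣ b[n-cd]≡pᵐad ⟩
      ℤ.∣ + (p ℕ.^ m) ℤ.* (a ℤ.* + suc d) ∣    ≡⟨ ℤ.abs-* (+ (p ℕ.^ m)) (a ℤ.* + suc d) ⟩
      p ℕ.^ m ℕ.* ℤ.∣ a ℤ.* + suc d ∣          ≡⟨ ℕ.*-comm (p ℕ.^ m) _ ⟩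
      ℤ.∣ a ℤ.* + suc d ∣ ℕ.* p ℕ.^ m          ∎))
    where
    open ≡-Reasoning
    X : ℤ
    X = c ℤ.* + b ℤ.+ + (p ℕ.^ m) ℤ.* a
    distribute : ∀ C P s B → (C + P * s) * B ≡ C * B + P * (s * B)
    distribute = solve 4 (λ C P s B → (C :+ P :* s) :* B := C :* B :+ P :* (s :* B)) refl
    qb≡X : q * ι b ≡ fromℤ X
    qb≡X = begin
      q * ι b                                         ≡⟨ cong (_* ι b) q≡c+pᵐs ⟩
      (fromℤ c + ι (p ℕ.^ m) * s) * ι b               ≡⟨ distribute (fromℤ c) (ι (p ℕ.^ m)) s (ι b) ⟩
      fromℤ c * ι b + ι (p ℕ.^ m) * (s * ι b)         ≡⟨ cong (λ t → fromℤ c * ι b + ι (p ℕ.^ m) * t) sb≡a ⟩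
      fromℤ c * ι b + ι (p ℕ.^ m) * fromℤ a           ≡⟨ cong₂ _+_ (fromℤ-homo-* c (+ b)) (fromℤ-homo-* (+ (p ℕ.^ m)) a) ⟨
      fromℤ (c ℤ.* + b) + fromℤ (+ (p ℕ.^ m) ℤ.* a)   ≡⟨ fromℤ-homo-+ (c ℤ.* + b) (+ (p ℕ.^ m) ℤ.* a) ⟨
      fromℤ X                                         ∎
    expand : ∀ b n c D → b ℤ.* (n ℤ.- c ℤ.* D) ≡ n ℤ.* b ℤ.- c ℤ.* b ℤ.* D
    expand = ℤ-solve-∀
    cancel : ∀ c b P a D → (c ℤ.* b ℤ.+ P ℤ.* a) ℤ.* D ℤ.- c ℤ.* b ℤ.* D ≡ P ℤ.* (a ℤ.* D)
    cancel = ℤ-solve-∀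
    b[n-cd]≡pᵐad : + b ℤ.* (n ℤ.- c ℤ.* + suc d) ≡ + (p ℕ.^ m) ℤ.* (a ℤ.* + suc d)
    b[n-cd]≡pᵐad = begin
      + b ℤ.* (n ℤ.- c ℤ.* + suc d)            ≡⟨ expand (+ b) n c (+ suc d) ⟩
      n ℤ.* + b ℤ.- c ℤ.* + b ℤ.* + suc d      ≡⟨ cong (λ t → t ℤ.- c ℤ.* + b ℤ.* + suc d) (cross-multiply q b X qb≡X) ⟩
      X ℤ.* + suc d ℤ.- c ℤ.* + b ℤ.* + suc d  ≡⟨ cancel c (+ b) (+ (p ℕ.^ m)) a (+ suc d) ⟩
      + (p ℕ.^ m) ℤ.* (a ℤ.* + suc d)          ∎

  congZp-lift : ∀ m {w x c} → w ≈ x → ι (p ℕ.^ m) * x ≡ fromℤ c → CongZp p (suc m) (ι (p ℕ.^ m) * w) c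
  congZp-lift m {w} {x} {c} (≈-intro _ _ t t∈ℤₚ w-x≡pt) pᵐx≡c = congZp-intro (suc m) {c = c} t∈ℤₚ (begin
    pᵐ * w                          ≡⟨ split pᵐ w x ⟩
    pᵐ * x + pᵐ * (w - x)           ≡⟨ cong₂ (λ y z → y + pᵐ * z) pᵐx≡c w-x≡pt ⟩
    fromℤ c + pᵐ * (ι p * t)        ≡⟨ cong (_+_ (fromℤ c)) (*-assoc pᵐ (ι p) t) ⟨
    fromℤ c + pᵐ * ι p * t          ≡⟨ cong (λ y → fromℤ c + y * t) (trans (ι-homo-* p (p ℕ.^ m)) (*-comm (ι p) pᵐ)) ⟨
    fromℤ c + ι (p ℕ.^ suc m) * t   ∎)
    where
    open ≡-Reasoning
    pᵐ = ι (p ℕ.^ m)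
    split : ∀ P w x → P * w ≡ P * x + P * (w - x)
    split = solve 3 (λ P w x → P :* w := P :* x :+ P :* (w :- x)) refl

module OneModThree (a : ℕ) .{{_ : NonZero a}} (prime : Prime (suc (3 ℕ.* a))) where
  open import Data.Nat.Base
  open import Data.Nat.Properties
    using (*-identityʳ; *-cancelˡ-≡; *-monoʳ-≤; *-distribˡ-+; +-suc; +-comm; +-assoc; +-identityʳ; +-monoʳ-≤;
           m≤m+n; m≤m*n; <⇒≱; n<1+n; <-trans; ≤-<-trans; suc-injective; module ≤-Reasoning)
  open import Data.Nat.DivMod using (m<n⇒m%n≡m)
  open import Data.Nat.Divisibility using (_∣_; divides; ∣⇒≤)
  open import Data.Nat.Tactic.RingSolver using (solve-∀)
  open import Data.Empty using (⊥-elim)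
  open import Relation.Nullary using (¬_)

  p : ℕ
  p = suc (3 * a)

  k : ℕ
  k = suc (a + a)

  open Congruence p
  open Wilson (3 * a) prime using (square-complement; factorial-reflection)
  open PrimeProduct (3 * a) prime using (prodCoprime-below; prodCoprime-mod²)

  private
    triple : ∀ a → a + a + a ≡ 3 * a
    triple = solve-∀

  k+a≡p : k + a ≡ p
  k+a≡p = cong suc (triple a)

  k<p : k < p
  k<p = s≤s (begin
    suc (a + a)    ≡⟨ +-comm 1 (a + a) ⟩
    a + a + 1      ≤⟨ +-monoʳ-≤ (a + a) (>-nonZero⁻¹ a) ⟩
    a + a + a      ≡⟨ triple a ⟩
    3 * a          ∎)
    where open ≤-Reasoning

  1+a<p : suc a < p
  1+a<p = ≤-<-trans (s≤s (m≤m+n a a)) k<p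

  p∤3 : ¬ p ∣ 3
  p∤3 p∣3 = <⇒≱ (s≤s (m≤m*n 3 a)) (∣⇒≤ p∣3)

  multiple-of-p : ∀ {x} → p ∣ x → 0 < x → x < p + p → x ≡ p
  multiple-of-p (divides 1 refl) _ _ = +-identityʳ p
  multiple-of-p (divides (suc (suc c)) refl) _ x<2p = ⊥-elim (<⇒≱ x<2p (+-monoʳ-≤ p (m≤m+n p (c * p))))

  p∤1+3j : ∀ j → j ≢ a → j ≤ a + a → ¬ p ∣ suc (3 * j)
  p∤1+3j j j≢a j≤2a p∣1+3j = j≢a (*-cancelˡ-≡ j a 3 (suc-injective (multiple-of-p p∣1+3j z<s 1+3j<2p)))
    where
    1+3j<2p : suc (3 * j) < p + p
    1+3j<2p = s≤s (begin
      suc (3 * j)              ≤⟨ s≤s (*-monoʳ-≤ 3 j≤2a) ⟩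
      suc (3 * (a + a))        ≡⟨ cong suc (*-distribˡ-+ 3 a a) ⟩
      suc (3 * a + 3 * a)      ≡⟨ +-suc (3 * a) (3 * a) ⟨
      3 * a + suc (3 * a)      ∎)
      where open ≤-Reasoning

  9k!²a!²≡1 : (3 * 3) * (k ! * k !) * (a ! * a !) ≡ₘ 1
  9k!²a!²≡1 = begin
    (3 * 3) * ((k * y) * (k * y)) * (x * x)     ≡⟨ regroup k 3 x y ⟩
    (k * k) * ((3 * 3) * ((x * y) * (x * y)))   ≈⟨ *-congʳ-≡ₘ _ (square-complement k a k+a≡p) ⟩
    (a * a) * ((3 * 3) * ((x * y) * (x * y)))   ≡⟨ regroup′ a 3 (x * y) ⟩
    ((3 * a) * (3 * a)) * ((x * y) * (x * y))   ≈⟨ *-cong-≡ₘ (square-complement (3 * a) 1 (+-comm (3 * a) 1))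
                                                              (factorial-reflection a (a + a) a+2a≡3a) ⟩
    1 * 1 * 1                                   ∎
    where
    open ≡ₘ-Reasoning
    x = a !
    y = (a + a) !
    a+2a≡3a : a + (a + a) ≡ 3 * a
    a+2a≡3a = trans (sym (+-assoc a a a)) (triple a)
    regroup : ∀ k t x y → (t * t) * ((k * y) * (k * y)) * (x * x) ≡ (k * k) * ((t * t) * ((x * y) * (x * y)))
    regroup = solve-∀
    regroup′ : ∀ a t z → (a * a) * ((t * t) * (z * z)) ≡ ((t * a) * (t * a)) * (z * z)
    regroup′ = solve-∀

  p∣3N-2⇒N%p≡1+a : ∀ N → ℤ.+ (p ^ 1) ℤ.∣ ℤ.+ 3 ℤ.* ℤ.+ N ℤ.- ℤ.+ 2 → N % p ≡ suc a
  p∣3N-2⇒N%p≡1+a N p∣3N-2 = trans (%-≡ N≡1+a) (m<n⇒m%n≡m 1+a<p)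
    where
    open ≡ₘ-Reasoning
    3N≡2 : 3 * N ≡ₘ 2
    3N≡2 = ∣-⇒≡ₘ (3 * N) 2 (subst₂ (λ q z → ℤ.+ q ℤ.∣ z ℤ.- ℤ.+ 2) (*-identityʳ p) (sym (ℤ.pos-* 3 N)) p∣3N-2)
    expand : ∀ N a → N + 2 * N * suc (3 * a) ≡ (1 + 2 * a) * (3 * N)
    expand = solve-∀
    collect : ∀ a → (1 + 2 * a) * 2 ≡ suc a + 1 * suc (3 * a)
    collect = solve-∀
    N≡1+a : N ≡ₘ suc a
    N≡1+a = begin
      N                        ≈⟨ +-*-≡ₘ N (2 * N) ⟨
      N + 2 * N * p            ≡⟨ expand N a ⟩
      (1 + 2 * a) * (3 * N)    ≈⟨ *-congˡ-≡ₘ (1 + 2 * a) 3N≡2 ⟩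
      (1 + 2 * a) * 2          ≡⟨ collect a ⟩
      suc a + 1 * p            ≈⟨ +-*-≡ₘ (suc a) 1 ⟩
      suc a                    ∎

  prodCoprime²≡a!² : ∀ N → N % p ≡ suc a → prodCoprime p N * prodCoprime p N ≡ₘ a ! * a !
  prodCoprime²≡a!² N N%p≡1+a = begin
    prodCoprime p N * prodCoprime p N              ≈⟨ prodCoprime-mod² N ⟩
    prodCoprime p (N % p) * prodCoprime p (N % p)  ≡⟨ cong (λ r → prodCoprime p r * prodCoprime p r) N%p≡1+a ⟩
    prodCoprime p (suc a) * prodCoprime p (suc a)  ≡⟨ cong (λ r → r * r) (prodCoprime-below a (<-trans (n<1+n a) 1+a<p)) ⟩
    a ! * a !                                      ∎
    where open ≡ₘ-Reasoning

module Proposition (a : ℕ) .{{_ : NonZero a}} (prime : Prime (suc (3 ℕ.* a))) where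
  open import Data.Integer.Base using (ℤ; +_)
  open import Data.Rational.Base
  open import Data.Rational.Properties using (*-comm; *-identityʳ; *-inverseˡ)
  open import Data.Rational.Solver using (module +-*-Solver)
  open +-*-Solver using (solve; _:+_; _:*_; _:-_; :-_; _:=_; con)
  open import Data.Nat.Tactic.RingSolver using (solve-∀)
  open import Function.Base using (_∘_)
  open Rationals
  open OneModThree a prime
  open Localisation p prime
  open Congruence p using (_≡ₘ_; *-cong-≡ₘ)

  ⅓ : ℚ
  ⅓ = + 1 / 3

  ⅓-integral : PIntegral ⅓
  ⅓-integral = 1/n-integral 2 p∤3

  ⅓+a≡p⅓ : ⅓ + ι a ≡ ι p * ⅓
  ⅓+a≡p⅓ = begin
    ⅓ + ι a                  ≡⟨ cong (_+_ ⅓) (*-identityʳ (ι a)) ⟨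
    ⅓ + ι a * 1ℚ             ≡⟨ cong (λ y → ⅓ + ι a * y) (1/n*n≡1 2) ⟨
    ⅓ + ι a * (⅓ * ι 3)      ≡⟨ factor ⅓ (ι a) (ι 3) ⟩
    (1ℚ + ι 3 * ι a) * ⅓     ≡⟨ cong (_* ⅓) (trans (ι-homo-+ 1 (3 ℕ.* a)) (cong (_+_ 1ℚ) (ι-homo-* 3 a))) ⟨
    ι p * ⅓                  ∎
    where
    open ≡-Reasoning
    factor : ∀ t x y → t + x * (t * y) ≡ (1ℚ + y * x) * t
    factor = solve 3 (λ t x y → t :+ x :* (t :* y) := (con 1ℚ :+ y :* x) :* t) refl

  ⅓≈-a : ⅓ ≈ - ι a
  ⅓≈-a = ≈-intro ⅓-integral (-‿integral (ι-integral a)) ⅓ ⅓-integral ⅓-[-a]≡p⅓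
    where
    ⅓-[-a]≡p⅓ : ⅓ - - ι a ≡ ι p * ⅓
    ⅓-[-a]≡p⅓ = trans (solve 2 (λ t x → t :- (:- x) := t :+ x) refl ⅓ (ι a)) ⅓+a≡p⅓

  ⅓+a+1≈1 : ⅓ + ι a + 1ℚ ≈ 1ℚ
  ⅓+a+1≈1 = begin
    ⅓ + ι a + 1ℚ      ≈⟨ +-cong (+-cong ⅓≈-a (≈-refl (ι-integral a))) (≈-refl (ι-integral 1)) ⟩
    - ι a + ι a + 1ℚ  ≡⟨ solve 1 (λ x → :- x :+ x :+ con 1ℚ := con 1ℚ) refl (ι a) ⟩
    1ℚ                ∎
    where open ≈-Reasoning

  R : ℚ
  R = poch ⅓ a * (⅓ * poch (⅓ + ι a + 1ℚ) a)

  poch-⅓-k : poch ⅓ k ≡ ι p * R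
  poch-⅓-k = begin
    poch ⅓ k                                              ≡⟨ cong (poch ⅓) (ℕ.+-suc a a) ⟨
    poch ⅓ (a ℕ.+ suc a)                                  ≡⟨ poch-+ ⅓ a (suc a) ⟩
    poch ⅓ a * poch (⅓ + ι a) (suc a)                     ≡⟨ cong (poch ⅓ a *_) (poch-suc (⅓ + ι a) a) ⟩
    poch ⅓ a * ((⅓ + ι a) * poch (⅓ + ι a + 1ℚ) a)        ≡⟨ cong (λ y → poch ⅓ a * (y * poch (⅓ + ι a + 1ℚ) a)) ⅓+a≡p⅓ ⟩
    poch ⅓ a * ((ι p * ⅓) * poch (⅓ + ι a + 1ℚ) a)        ≡⟨ regroup (poch ⅓ a) (ι p) ⅓ (poch (⅓ + ι a + 1ℚ) a) ⟩
    ι p * R                                               ∎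
    where
    open ≡-Reasoning
    regroup : ∀ A P t B → A * ((P * t) * B) ≡ P * (A * (t * B))
    regroup = solve 4 (λ A P t B → A :* ((P :* t) :* B) := P :* (A :* (t :* B))) refl

  F : ℚ
  F = ι (a !) * ι (a !)

  F-integral : PIntegral F
  F-integral = *-integral (ι-integral (a !)) (ι-integral (a !))

  R²≈F²⅓² : R * R ≈ F * F * (⅓ * ⅓)
  R²≈F²⅓² = begin
    R * R                                     ≡⟨ regroup A ⅓ B ⟩
    (A * A) * (B * B) * (⅓ * ⅓)               ≈⟨ *-cong (*-cong (*-cong A≈ A≈) (*-cong B≈ B≈)) (≈-refl ⅓²-integral) ⟩
    (A′ * A′) * (B′ * B′) * (⅓ * ⅓)           ≡⟨ cong₂ (λ x y → x * y * (⅓ * ⅓)) (poch-neg² a) B′²≡F ⟩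
    F * F * (⅓ * ⅓)                           ∎
    where
    open ≈-Reasoning
    A = poch ⅓ a
    B = poch (⅓ + ι a + 1ℚ) a
    A′ = poch (- ι a) a
    B′ = poch 1ℚ a
    A≈ : A ≈ A′
    A≈ = poch-cong ⅓≈-a a
    B≈ : B ≈ B′
    B≈ = poch-cong ⅓+a+1≈1 a
    B′²≡F : B′ * B′ ≡ F
    B′²≡F = cong (λ y → y * y) (poch-1 a)
    ⅓²-integral : PIntegral (⅓ * ⅓)
    ⅓²-integral = *-integral ⅓-integral ⅓-integral
    regroup : ∀ A t B → (A * (t * B)) * (A * (t * B)) ≡ (A * A) * (B * B) * (t * t)
    regroup = solve 3 (λ A t B → (A :* (t :* B)) :* (A :* (t :* B)) := (A :* A) :* (B :* B) :* (t :* t)) refl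

  -- The summand 4p²/(3i − 2)² of Defs.lhs, which is local to its where block there.
  term : ℕ → ℚ
  term zero    = 0ℚ
  term (suc j) = ι (4 ℕ.* p ℕ.* p) * r * r
    where r = + 1 / suc (3 ℕ.* j)

  term≈0 : ∀ i → 0 ℕ.< i → i ℕ.≤ k → i ≢ suc a → term i ≈ 0ℚ
  term≈0 (suc j) _ (ℕ.s≤s j≤2a) 1+j≢1+a = begin
    ι (4 ℕ.* p ℕ.* p) * r * r      ≡⟨ cong (λ y → y * r * r) (ι-homo-* (4 ℕ.* p) p) ⟩
    ι (4 ℕ.* p) * ι p * r * r      ≡⟨ pull-p (ι (4 ℕ.* p)) (ι p) r ⟩
    ι p * (ι (4 ℕ.* p) * r * r)    ≈⟨ p*≈0 (*-integral (*-integral (ι-integral (4 ℕ.* p)) r-integral) r-integral) ⟩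
    0ℚ                             ∎
    where
    open ≈-Reasoning
    r = + 1 / suc (3 ℕ.* j)
    r-integral : PIntegral r
    r-integral = 1/n-integral (3 ℕ.* j) (p∤1+3j j (1+j≢1+a ∘ cong suc) j≤2a)
    pull-p : ∀ c P r → c * P * r * r ≡ P * (c * r * r)
    pull-p = solve 3 (λ c P r → c :* P :* r :* r := P :* (c :* r :* r)) refl

  term-a≡4 : term (suc a) ≡ ι 4
  term-a≡4 = begin
    ι (4 ℕ.* p ℕ.* p) * r * r      ≡⟨ cong (λ y → y * r * r) (trans (ι-homo-* (4 ℕ.* p) p) (cong (_* ι p) (ι-homo-* 4 p))) ⟩
    ι 4 * ι p * ι p * r * r        ≡⟨ regroup (ι 4) (ι p) r ⟩
    ι 4 * (r * ι p) * (r * ι p)    ≡⟨ cong (λ y → ι 4 * y * y) (1/n*n≡1 (3 ℕ.* a)) ⟩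
    ι 4 * 1ℚ * 1ℚ                  ≡⟨ trans (*-identityʳ (ι 4 * 1ℚ)) (*-identityʳ (ι 4)) ⟩
    ι 4                            ∎
    where
    open ≡-Reasoning
    r = + 1 / p
    regroup : ∀ c P r → c * P * P * r * r ≡ c * (r * P) * (r * P)
    regroup = solve 3 (λ c P r → c :* P :* P :* r :* r := c :* (r :* P) :* (r :* P)) refl

  ∑term≈4 : sumFrom1 term k ≈ ι 4
  ∑term≈4 = ≈-trans
    (sumFrom1-single (suc a) k ℕ.z<s (ℕ.s≤s (ℕ.m≤m+n a a)) (subst PIntegral (sym term-a≡4) (ι-integral 4)) term≈0)
    (≡⇒≈ (subst PIntegral (sym term-a≡4) (ι-integral 4)) term-a≡4)

  B : ℚ
  B = (1ℚ + ι (6 ℕ.* p ℕ.* p)) - sumFrom1 term k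

  B≈-3 : B ≈ - ι 3
  B≈-3 = begin
    (1ℚ + ι (6 ℕ.* p ℕ.* p)) - sumFrom1 term k   ≈⟨ +-cong (+-cong (≈-refl (ι-integral 1)) 6p²≈0) (-‿cong ∑term≈4) ⟩
    (1ℚ + 0ℚ) - ι 4                              ≡⟨⟩
    - ι 3                                        ∎
    where
    open ≈-Reasoning
    6p²≈0 : ι (6 ℕ.* p ℕ.* p) ≈ 0ℚ
    6p²≈0 = begin
      ι (6 ℕ.* p ℕ.* p)    ≡⟨ trans (ι-homo-* (6 ℕ.* p) p) (*-comm (ι (6 ℕ.* p)) (ι p)) ⟩
      ι p * ι (6 ℕ.* p)    ≈⟨ p*≈0 (ι-integral (6 ℕ.* p)) ⟩
      0ℚ                   ∎

  K : ℕ
  K = k ! ℕ.* k !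

  ιK≢0 : ι K ≢ 0ℚ
  ιK≢0 ιK≡0 = ℕ.≢-nonZero⁻¹ K {{ℕ._!*_!≢0 k k}} (ι-injective ιK≡0)

  u : ℚ
  u = (1/ ι K) {{≢-nonZero ιK≢0}}

  u*K≡1 : u * ι K ≡ 1ℚ
  u*K≡1 = *-inverseˡ (ι K) {{≢-nonZero ιK≢0}}

  u-integral : PIntegral u
  u-integral = integral (+ 1) K (p∤* (p∤! k k<p) (p∤! k k<p)) u*K≡1

  ⅓²u≈F : ⅓ * ⅓ * u ≈ F
  ⅓²u≈F = begin
    ⅓ * ⅓ * u                                  ≡⟨ *-identityʳ (⅓ * ⅓ * u) ⟨
    ⅓ * ⅓ * u * 1ℚ                             ≈⟨ *-cong (≈-refl ⅓²u-integral) (≡ₘ⇒≈ 9k!²a!²≡1) ⟨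
    ⅓ * ⅓ * u * ι (3 ℕ.* 3 ℕ.* K ℕ.* (a ! ℕ.* a !))  ≡⟨ cong (⅓ * ⅓ * u *_) expand ⟩
    ⅓ * ⅓ * u * (ι 3 * ι 3 * ι K * F)          ≡⟨ regroup ⅓ u (ι 3) (ι K) F ⟩
    (⅓ * ι 3) * (⅓ * ι 3) * (u * ι K) * F      ≡⟨ cong₂ (λ x y → x * x * y * F) (1/n*n≡1 2) u*K≡1 ⟩
    1ℚ * 1ℚ * 1ℚ * F                           ≡⟨ solve 1 (λ F → con 1ℚ :* con 1ℚ :* con 1ℚ :* F := F) refl F ⟩
    F                                          ∎
    where
    open ≈-Reasoning
    ⅓²u-integral : PIntegral (⅓ * ⅓ * u)
    ⅓²u-integral = *-integral (*-integral ⅓-integral ⅓-integral) u-integral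
    expand : ι (3 ℕ.* 3 ℕ.* K ℕ.* (a ! ℕ.* a !)) ≡ ι 3 * ι 3 * ι K * F
    expand = trans (ι-homo-* (3 ℕ.* 3 ℕ.* K) (a ! ℕ.* a !))
                   (cong₂ _*_ (trans (ι-homo-* (3 ℕ.* 3) K) (cong (_* ι K) (ι-homo-* 3 3))) (ι-homo-* (a !) (a !)))
    regroup : ∀ t u T K F → t * t * u * (T * T * K * F) ≡ (t * T) * (t * T) * (u * K) * F
    regroup = solve 5 (λ t u T K F → t :* t :* u :* (T :* T :* K :* F) := (t :* T) :* (t :* T) :* (u :* K) :* F) refl

  Γp⁶≈F³ : ∀ N → N ℕ.% p ≡ suc a → fromℤ (Γp p N ℤ.^ 6) ≈ F * (F * F)
  Γp⁶≈F³ N N%p≡1+a = begin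
    fromℤ (Γp p N ℤ.^ 6)          ≡⟨ cong fromℤ (GammaPower.Γp^6 p N) ⟩
    ι (prodCoprime p N ℕ.^ 6)     ≡⟨ cong ι (sixth (prodCoprime p N)) ⟩
    ι (y ℕ.* (y ℕ.* y))           ≈⟨ ≡ₘ⇒≈ (*-cong-≡ₘ y≡x² (*-cong-≡ₘ y≡x² y≡x²)) ⟩
    ι (x² ℕ.* (x² ℕ.* x²))        ≡⟨ ι-homo-* x² (x² ℕ.* x²) ⟩
    ι x² * ι (x² ℕ.* x²)          ≡⟨ cong (_*_ (ι x²)) (ι-homo-* x² x²) ⟩
    ι x² * (ι x² * ι x²)          ≡⟨ cong (λ y → y * (y * y)) ιx²≡F ⟩
    F * (F * F)                   ∎
    where
    open ≈-Reasoning
    x² = a ! ℕ.* a !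
    y = prodCoprime p N ℕ.* prodCoprime p N
    y≡x² : y ≡ₘ x²
    y≡x² = prodCoprime²≡a!² N N%p≡1+a
    ιx²≡F : ι x² ≡ F
    ιx²≡F = ι-homo-* (a !) (a !)
    sixth : ∀ x → x ℕ.* (x ℕ.* (x ℕ.* (x ℕ.* (x ℕ.* (x ℕ.* 1))))) ≡ (x ℕ.* x) ℕ.* ((x ℕ.* x) ℕ.* (x ℕ.* x))
    sixth = solve-∀

  W : ℚ
  W = R * R * u * B

  [2p+1]/3≡k : (2 ℕ.* p ℕ.+ 1) ℕ./ 3 ≡ k
  [2p+1]/3≡k = trans (cong (ℕ._/ 3) (thrice a)) (ℕ.m*n/n≡m k 3)
    where
    thrice : ∀ a → 2 ℕ.* suc (3 ℕ.* a) ℕ.+ 1 ≡ suc (a ℕ.+ a) ℕ.* 3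
    thrice = solve-∀

  lhs≡p²W : lhs p ≡ ι (p ℕ.^ 2) * W
  lhs≡p²W = begin
    lhs p                                                ≡⟨ cong (λ s → L₀ m * ((1ℚ + ι (6 ℕ.* p ℕ.* p)) - s))
                                                                 (sumFrom1-cong (λ { zero → refl ; (suc j) → refl }) m) ⟩
    L m                                                  ≡⟨ cong L [2p+1]/3≡k ⟩
    L k                                                  ≡⟨ cong (λ d → ((poch ⅓ k * poch ⅓ k) ÷' d) * B) 1ₖ²≡ιK ⟩
    ((poch ⅓ k * poch ⅓ k) ÷' ι K) * B                   ≡⟨ cong (_* B) (÷′-≢0 (poch ⅓ k * poch ⅓ k) (ι K) ιK≢0) ⟩
    (poch ⅓ k * poch ⅓ k) * u * B                        ≡⟨ cong (λ y → y * y * u * B) poch-⅓-k ⟩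
    (ι p * R) * (ι p * R) * u * B                        ≡⟨ regroup (ι p) R u B ⟩
    (ι p * ι p) * W                                      ≡⟨ cong (_* W) ιp²≡ιp*ιp ⟨
    ι (p ℕ.^ 2) * W                                      ∎
    where
    open ≡-Reasoning
    m = (2 ℕ.* p ℕ.+ 1) ℕ./ 3
    L₀ : ℕ → ℚ
    L₀ n = (poch ⅓ n * poch ⅓ n) ÷' (poch 1ℚ n * poch 1ℚ n)
    L : ℕ → ℚ
    L n = L₀ n * ((1ℚ + ι (6 ℕ.* p ℕ.* p)) - sumFrom1 term n)
    1ₖ²≡ιK : poch 1ℚ k * poch 1ℚ k ≡ ι K
    1ₖ²≡ιK = trans (cong (λ y → y * y) (poch-1 k)) (sym (ι-homo-* (k !) (k !)))
    ιp²≡ιp*ιp : ι (p ℕ.^ 2) ≡ ι p * ι p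
    ιp²≡ιp*ιp = trans (ι-homo-* p (p ℕ.* 1)) (cong (λ n → ι p * ι n) (ℕ.*-identityʳ p))
    regroup : ∀ P R u B → (P * R) * (P * R) * u * B ≡ (P * P) * (R * R * u * B)
    regroup = solve 4 (λ P R u B → (P :* R) :* (P :* R) :* u :* B := (P :* P) :* (R :* R :* u :* B)) refl

  W≈-3Γp⁶ : ∀ N → N ℕ.% p ≡ suc a → W ≈ - ι 3 * fromℤ (Γp p N ℤ.^ 6)
  W≈-3Γp⁶ N N%p≡1+a = begin
    R * R * u * B                      ≈⟨ *-cong (*-cong R²≈F²⅓² (≈-refl u-integral)) B≈-3 ⟩
    F * F * (⅓ * ⅓) * u * - ι 3        ≡⟨ regroup F (⅓ * ⅓) u (- ι 3) ⟩
    F * F * (⅓ * ⅓ * u) * - ι 3        ≈⟨ *-cong (*-cong (≈-refl (*-integral F-integral F-integral)) ⅓²u≈F) (≈-refl -3-integral) ⟩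
    F * F * F * - ι 3                  ≡⟨ rotate F (- ι 3) ⟩
    - ι 3 * (F * (F * F))              ≈⟨ *-cong (≈-refl -3-integral) (Γp⁶≈F³ N N%p≡1+a) ⟨
    - ι 3 * fromℤ (Γp p N ℤ.^ 6)       ∎
    where
    open ≈-Reasoning
    -3-integral : PIntegral (- ι 3)
    -3-integral = -‿integral (ι-integral 3)
    regroup : ∀ F t u c → F * F * t * u * c ≡ F * F * (t * u) * c
    regroup = solve 4 (λ F t u c → F :* F :* t :* u :* c := F :* F :* (t :* u) :* c) refl
    rotate : ∀ F c → F * F * F * c ≡ c * (F * (F * F))
    rotate = solve 2 (λ F c → F :* F :* F :* c := c :* (F :* (F :* F))) refl

  proposition : ∀ N → ℤ.+ (p ℕ.^ 1) ℤ.∣ ℤ.+ 3 ℤ.* ℤ.+ N ℤ.- ℤ.+ 2 →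
                CongZp p 3 (lhs p) (ℤ.- ℤ.+ 3 ℤ.* ℤ.+ (p ℕ.^ 2) ℤ.* Γp p N ℤ.^ 6)
  proposition N p∣3N-2 = subst (λ q → CongZp p 3 q c) (sym lhs≡p²W)
    (congZp-lift 2 {c = c} (W≈-3Γp⁶ N (p∣3N-2⇒N%p≡1+a N p∣3N-2)) (sym fromℤc≡))
    where
    open ≡-Reasoning
    c = ℤ.- ℤ.+ 3 ℤ.* ℤ.+ (p ℕ.^ 2) ℤ.* Γp p N ℤ.^ 6
    G = fromℤ (Γp p N ℤ.^ 6)
    fromℤc≡ : fromℤ c ≡ ι (p ℕ.^ 2) * (- ι 3 * G)
    fromℤc≡ = begin
      fromℤ c                                     ≡⟨ fromℤ-homo-* (ℤ.- ℤ.+ 3 ℤ.* ℤ.+ (p ℕ.^ 2)) (Γp p N ℤ.^ 6) ⟩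
      fromℤ (ℤ.- ℤ.+ 3 ℤ.* ℤ.+ (p ℕ.^ 2)) * G     ≡⟨ cong (_* G) (fromℤ-homo-* (ℤ.- ℤ.+ 3) (ℤ.+ (p ℕ.^ 2))) ⟩
      fromℤ (ℤ.- ℤ.+ 3) * ι (p ℕ.^ 2) * G         ≡⟨ cong (λ y → y * ι (p ℕ.^ 2) * G) (fromℤ-homo‿- (ℤ.+ 3)) ⟩
      - ι 3 * ι (p ℕ.^ 2) * G                     ≡⟨ solve 3 (λ c P G → c :* P :* G := P :* (c :* G)) refl (- ι 3) (ι (p ℕ.^ 2)) G ⟩
      ι (p ℕ.^ 2) * (- ι 3 * G)                   ∎

open import Data.Nat using (ℕ; _%_; _^_)
open import Data.Nat.Primality using (Prime)
open import Data.Integer using (+_; _-_; _*_; -_) renaming (_^_ to _^ℤ_)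
open import Data.Integer.Divisibility using (_∣_)
open import Data.Product using (∃-syntax)
open import Relation.Binary.PropositionalEquality using (_≡_)

p%3≡1⇒p≡1+3a : ∀ p → Prime p → p % 3 ≡ 1 → ∃[ a ] (NonZero a × p ≡ suc (3 ℕ.* a))
p%3≡1⇒p≡1+3a p p-prime p%3≡1 = p ℕ./ 3 , ℕ.≢-nonZero p/3≢0 , p≡1+3[p/3]
  where
  p≡1+3[p/3] : p ≡ suc (3 ℕ.* (p ℕ./ 3))
  p≡1+3[p/3] = trans (ℕ.m≡m%n+[m/n]*n p 3) (cong₂ ℕ._+_ p%3≡1 (ℕ.*-comm (p ℕ./ 3) 3))
  p/3≢0 : p ℕ./ 3 ≢ 0
  p/3≢0 p/3≡0 = ℕ.nonTrivial⇒≢1 {{prime⇒nonTrivial p-prime}} (trans p≡1+3[p/3] (cong (λ a → suc (3 ℕ.* a)) p/3≡0))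

p%6≡1⇒p%3≡1 : ∀ p → p % 6 ≡ 1 → p % 3 ≡ 1
p%6≡1⇒p%3≡1 p p%6≡1 = trans (sym (ℕ.m∣n⇒o%n%m≡o%m 3 6 p (ℕ.divides 2 refl))) (cong (_% 3) p%6≡1)

-- Only Γ_p(2/3)⁶ modulo p matters, so N with p ∣ 3N − 2 (M = 1) already represents 2/3 well enough.
proposition1p5 : (p : ℕ) → Prime p → p % 6 ≡ 1 →
    ∃[ M ] ((N : ℕ) → (+ (p ^ M)) ∣ ((+ 3) * (+ N) - (+ 2)) →
      CongZp p 3 (lhs p) ((- (+ 3)) * (+ (p ^ 2)) * (Γp p N ^ℤ 6)))
proposition1p5 p p-prime p%6≡1 with p%3≡1⇒p≡1+3a p p-prime (p%6≡1⇒p%3≡1 p p%6≡1)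
... | a , a≢0 , refl = 1 , Proposition.proposition a {{a≢0}} p-prime
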